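{- Let $G$ be a connected graph of order $n$ and let $H$ be a tree of order at least three whose root vertex $v$ is not an end vertex (vertex of degree one) of $H$. Then $\gamma_c(G\circ H)=n\gamma_c(H)$.
   Context: All graphs are finite, simple and undirected. A connected dominating set of a connected graph is a set $D$ of vertices such that every vertex outside $D$ has a neighbor in $D$ and $D$ induces a connected subgraph; $\gamma_c$ is the minimum cardinality of such a set. For $G$ with vertex set $\{v_1,\dots,v_n\}$ and $H$ with root $v$, the rooted product $G\circ H$ is obtained from one copy of $G$ and $n$ copies $H_1,\dots,H_n$ of $H$ by identifying each $v_i$ with the copy of $v$ in $H_i$. -}

module Defs where

open import Data.Nat using (ℕ; zero; suc; _*_; _≤_; _≥_)
open import Data.Bool using (Bool; true; false; T; _∧_; _∨_)
open import Data.Fin using (Fin; remQuot; _≟_)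
open import Data.Fin.Subset using (Subset; _∈_; ∣_∣)
open import Data.List using (List; []; _∷_; length; filter; head; last)
open import Data.List.Relation.Unary.Unique.Propositional using (Unique)
open import Data.Maybe using (just)
open import Data.List using (allFin)
open import Data.Product using (Σ; ∃; _×_; _,_; proj₁; proj₂)
open import Data.Sum using (_⊎_)
open import Data.Empty using (⊥)
open import Relation.Nullary using (¬_; does)
open import Relation.Binary.PropositionalEquality using (_≡_)

record Graph (n : ℕ) : Set where
  constructor mkGraph
  field
    adj : Fin n → Fin n → Bool
open Graph public

IsSimple : ∀ {n} → Graph n → Set
IsSimple G = (∀ u v → adj G u v ≡ adj G v u) × (∀ v → adj G v v ≡ false)

Adj : ∀ {n} → Graph n → Fin n → Fin n → Set
Adj G u v = T (adj G u v)

data WalkIn {n} (G : Graph n) (P : Fin n → Set) : Fin n → Fin n → Set where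
  stay : ∀ {u} → P u → WalkIn G P u u
  step : ∀ {u v w} → P u → Adj G u v → WalkIn G P v w → WalkIn G P u w

Connected : ∀ {n} → Graph n → Set
Connected {n} G = (n ≥ 1) × (∀ u v → WalkIn G (λ _ → Data.Unit.⊤) u v)
  where import Data.Unit

data Chain {n} (G : Graph n) : List (Fin n) → Set where
  []  : Chain G []
  [-] : ∀ {u} → Chain G (u ∷ [])
  _∷_ : ∀ {u v vs} → Adj G u v → Chain G (v ∷ vs) → Chain G (u ∷ v ∷ vs)

IsCycle : ∀ {n} → Graph n → List (Fin n) → Set
IsCycle G vs =
  (length vs ≥ 3) × Unique vs × Chain G vs ×
  Σ _ λ a → Σ _ λ b → (head vs ≡ just a) × (last vs ≡ just b) × Adj G b a

Tree : ∀ {n} → Graph n → Set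
Tree G = Connected G × (∀ vs → ¬ IsCycle G vs)

degree : ∀ {n} → Graph n → Fin n → ℕ
degree {n} G v = length (filter (λ u → T? (adj G v u)) (allFin n))
  where open import Data.Bool using (T?)

IsCDS : ∀ {n} → Graph n → Subset n → Set
IsCDS G D =
  (∀ v → v ∈ D ⊎ ∃ λ u → u ∈ D × Adj G v u) ×
  (∀ u v → u ∈ D → v ∈ D → WalkIn G (_∈ D) u v)

IsConnDomNumber : ∀ {n} → Graph n → ℕ → Set
IsConnDomNumber G k =
  (∃ λ D → IsCDS G D × ∣ D ∣ ≡ k) × (∀ D → IsCDS G D → k ≤ ∣ D ∣)

-- Vertex combine i a ∈ Fin (n * m)
-- is vertex a of the copy H_i; the vertex (i , r) is identified with v_i of G.
-- (i,a) ~ (j,b)  iff  (i = j and a ~_H b)  or  (a = b = r and i ~_G j).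
rootedProduct : ∀ {n m} → Graph n → Graph m → Fin m → Graph (n * m)
rootedProduct G H r = mkGraph (rootedAdj G H r)
  where
  rootedAdj : ∀ {n m} → Graph n → Graph m → Fin m → Fin (n * m) → Fin (n * m) → Bool
  rootedAdj {n} {m} G H r x y with remQuot {n} m x | remQuot {n} m y
  ... | i , a | j , b =
    (does (i ≟ j) ∧ adj H a b) ∨ (does (a ≟ r) ∧ does (b ≟ r) ∧ adj G i j)

-- The structural fact behind the theorem is that r is a cut vertex of H:
-- it has two neighbours a, b such that every a–b walk passes through r
-- (r has a neighbour and degree ≠ 1, hence two neighbours, and an
-- r-avoiding walk between them would close a cycle).  Consequently every
-- linked vertex set dominating all vertices other than r contains r.
--
-- Upper bound: copying a minimum CDS S of H (which
-- contains r) into every copy H_i gives a CDS of size n·|S|, connected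
-- through the roots.  Lower bound: for a CDS D, its trace D_i on H_i is
-- linked (project walks of D onto H_i, sending other copies to r) and
-- dominates every non-root vertex; so r ∈ D_i, and then D_i is a CDS of H.
-- Summing over the copies, |D| = Σ |D_i| ≥ n·γ_c(H).
module Submission where

open import Defs
open import Data.Nat using (zero; suc; _+_; _*_; _≤_; _≥_; z≤n; s≤s)
open import Data.Nat.Properties using (+-mono-≤; ≤-trans; n≤1+n)
open import Data.Bool using (Bool; true; false; T; T?; _∧_; _∨_)
open import Data.Bool.Properties using (T-∧; T-∨)
open import Data.Fin using (Fin; zero; suc; combine; remQuot; _≟_)
open import Data.Fin.Properties using (remQuot-combine; combine-remQuot)
open import Data.Fin.Subset using (Subset; _∈_; _∉_; ∣_∣)
open import Data.Fin.Subset.Properties using (_∈?_)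
open import Data.Vec using (Vec; []; _∷_; _++_; lookup; concat; replicate; group)
open import Data.Vec.Properties using (lookup-concat; lookup-replicate; lookup⇒[]=; []=⇒lookup)
open import Data.List using (List; []; _∷_; length; filter; last; allFin)
import Data.List.Relation.Unary.All as All
open import Data.List.Relation.Unary.All using (All; []; _∷_)
open import Data.List.Relation.Unary.All.Properties using (¬Any⇒All¬)
open import Data.List.Relation.Unary.Any using (here; there; any?)
open import Data.List.Relation.Unary.AllPairs.Core using ([]; _∷_)
open import Data.List.Relation.Unary.Unique.Propositional using (Unique)
open import Data.List.Relation.Unary.Unique.Propositional.Properties using (filter⁺; allFin⁺)
open import Data.List.Membership.Propositional using () renaming (_∈_ to _∈ₗ_)
open import Data.List.Membership.Propositional.Properties using (∈-filter⁺; ∈-filter⁻; ∈-allFin)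
open import Data.Maybe using (just)
open import Data.Product using (∃; ∃₂; _×_; _,_; proj₁; proj₂)
open import Data.Sum using (_⊎_; inj₁; inj₂)
open import Data.Unit using (⊤)
open import Data.Empty using (⊥-elim)
open import Function using (_∘_; id)
open import Function.Bundles using (Equivalence)
open import Relation.Nullary using (¬_; Dec; does; yes; no)
open import Relation.Binary.PropositionalEquality
  using (_≡_; _≢_; refl; sym; trans; cong; cong₂; subst; subst₂)

T-does⁺ : ∀ {A : Set} (d : Dec A) → A → T (does d)
T-does⁺ (yes _) _ = _
T-does⁺ (no ¬a) a = ¬a a

T-does⁻ : ∀ {A : Set} (d : Dec A) → T (does d) → A
T-does⁻ (yes a) _ = a

infixr 5 _▸_
_▸_ : ∀ {n} {G : Graph n} {P : Fin n → Set} {u v w} →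
      WalkIn G P u v → WalkIn G P v w → WalkIn G P u w
stay _     ▸ w′ = w′
step p e w ▸ w′ = step p e (w ▸ w′)

walkStart : ∀ {n} {G : Graph n} {P : Fin n → Set} {u v} → WalkIn G P u v → P u
walkStart (stay p)     = p
walkStart (step p _ _) = p

reverse : ∀ {n} {G : Graph n} {P : Fin n → Set} →
          (∀ {x y} → Adj G x y → Adj G y x) →
          ∀ {u v} → WalkIn G P u v → WalkIn G P v u
reverse symmetric (stay p)     = stay p
reverse symmetric (step p e w) =
  reverse symmetric w ▸ step (walkStart w) (symmetric e) (stay p)

mapWalk : ∀ {n n′} {G : Graph n} {G′ : Graph n′} {P : Fin n → Set} {Q : Fin n′ → Set}
          (f : Fin n → Fin n′) →
          (∀ {x y} → Adj G x y → f x ≡ f y ⊎ Adj G′ (f x) (f y)) →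
          (∀ {x} → P x → Q (f x)) →
          ∀ {u v} → WalkIn G P u v → WalkIn G′ Q (f u) (f v)
mapWalk f hom mem (stay p) = stay (mem p)
mapWalk {G′ = G′} {Q = Q} f hom mem {v = v} (step p e w) with hom e
... | inj₁ same = subst (λ z → WalkIn G′ Q z (f v)) (sym same) (mapWalk f hom mem w)
... | inj₂ e′   = step (mem p) e′ (mapWalk f hom mem w)

restrict : ∀ {n} {G : Graph n} {P Q : Fin n → Set} →
           (∀ {x} → P x → Q x) → ∀ {u v} → WalkIn G P u v → WalkIn G Q u v
restrict = mapWalk id inj₂

Dominated : ∀ {n} → Graph n → Subset n → Fin n → Set
Dominated G S v = v ∈ S ⊎ ∃ λ u → u ∈ S × Adj G v u

Linked : ∀ {n} → Graph n → Subset n → Set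
Linked G S = ∀ u v → u ∈ S → v ∈ S → WalkIn G (_∈ S) u v

module _ {m} {H : Graph m} where

  record Path (Q : Fin m → Set) (a b : Fin m) : Set where
    constructor mkPath
    field
      rest     : List (Fin m)
      distinct : Unique (a ∷ rest)
      chain    : Chain H (a ∷ rest)
      ends     : last (a ∷ rest) ≡ just b
      inside   : All Q (a ∷ rest)

  shortcut : ∀ {Q x u b} (p : Path Q x b) → u ∈ₗ x ∷ Path.rest p → Path Q u b
  shortcut p (here refl) = p
  shortcut (mkPath [] _ _ _ _) (there ())
  shortcut (mkPath (_ ∷ ys) (_ ∷ un) (_ ∷ ch) la (_ ∷ al)) (there u∈) =
    shortcut (mkPath ys un ch la al) u∈

  -- Every walk contains a path: cut out the loop at each repeated vertex.
  walk⇒path : ∀ {Q a b} → WalkIn H Q a b → Path Q a b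
  walk⇒path (stay q) = mkPath [] ([] ∷ []) [-] refl (q ∷ [])
  walk⇒path {a = a} (step q e w) with walk⇒path w
  ... | p@(mkPath rest un ch la al) with any? (a ≟_) (_ ∷ rest)
  ...   | yes a∈ = shortcut p a∈
  ...   | no a∉  = mkPath (_ ∷ rest) (¬Any⇒All¬ _ a∉ ∷ un) (e ∷ ch) la (q ∷ al)

Separates : ∀ {m} → Graph m → Fin m → Set
Separates H r = ∃₂ λ a b → Adj H r a × Adj H r b × ¬ WalkIn H (_≢ r) a b

module _ {m} {H : Graph m} (simple : IsSimple H) where

  adj-sym : ∀ {u v} → Adj H u v → Adj H v u
  adj-sym {u} {v} = subst T (proj₁ simple u v)

  adj-irrefl : ∀ {u v} → Adj H u v → u ≢ v
  adj-irrefl {u} e refl = subst T (proj₂ simple u) e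

  -- In an acyclic graph, an r-avoiding walk between two distinct
  -- neighbours of r would, together with r, close a cycle.
  acyclic⇒separates : (∀ vs → ¬ IsCycle H vs) → ∀ {r a b} →
    Adj H r a → Adj H r b → a ≢ b → ¬ WalkIn H (_≢ r) a b
  acyclic⇒separates acyclic {r} {a} {b} ra rb a≢b w with walk⇒path w
  ... | mkPath [] _ _ refl _ = a≢b refl
  ... | mkPath (x ∷ xs) un ch la al =
    acyclic (r ∷ a ∷ x ∷ xs)
      ( s≤s (s≤s (s≤s z≤n))
      , All.map (λ x≢r r≡x → x≢r (sym r≡x)) al ∷ un
      , ra ∷ ch
      , r , b , refl , la , adj-sym rb )

  module _ {r : Fin m} {S : Subset m} (r∉S : r ∉ S) where

    avoids : ∀ {x} → x ∈ S → x ≢ r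
    avoids x∈ refl = r∉S x∈

    reachSet : (∀ v → v ≢ r → Dominated H S v) →
      ∀ {v} → Adj H r v → ∃ λ u → u ∈ S × WalkIn H (_≢ r) v u
    reachSet dom {v} rv with dom v (adj-irrefl rv ∘ sym)
    ... | inj₁ v∈             = v , v∈ , stay (avoids v∈)
    ... | inj₂ (u , u∈ , vu) = u , u∈ , step (adj-irrefl rv ∘ sym) vu (stay (avoids u∈))

  -- A linked set dominating every vertex other than a cut vertex r must
  -- contain r: otherwise it would join the two separated neighbours.
  cutVertex∈ : ∀ {r} → Separates H r → ∀ S →
    (∀ v → v ≢ r → Dominated H S v) → Linked H S → r ∈ S
  cutVertex∈ {r} (a , b , ra , rb , noWalk) S dom link with r ∈? S
  ... | yes r∈ = r∈
  ... | no r∉ with reachSet r∉ dom ra | reachSet r∉ dom rb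
  ... | ua , ua∈ , wa | ub , ub∈ , wb =
    ⊥-elim (noWalk (wa ▸ restrict (avoids r∉) (link ua ub ua∈ ub∈) ▸ reverse adj-sym wb))

module _ {m} {H : Graph m} {r : Fin m} where

  pickTwo : ∀ (L : List (Fin m)) → Unique L → (∀ {x} → x ∈ₗ L → Adj H r x) →
    ∀ {v} → v ∈ₗ L → length L ≢ 1 → ∃₂ λ a b → Adj H r a × Adj H r b × a ≢ b
  pickTwo (x ∷ [])    _                 _   _ ≢1 = ⊥-elim (≢1 refl)
  pickTwo (x ∷ y ∷ _) ((x≢y ∷ _) ∷ _) nbr _ _  =
    x , y , nbr (here refl) , nbr (there (here refl)) , x≢y

  twoNeighbours : ∀ {v} → Adj H r v → degree H r ≢ 1 →
    ∃₂ λ a b → Adj H r a × Adj H r b × a ≢ b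
  twoNeighbours rv =
    pickTwo neighbours (filter⁺ isNbr? (allFin⁺ m))
      (proj₂ ∘ ∈-filter⁻ isNbr? {xs = allFin m}) (∈-filter⁺ isNbr? (∈-allFin _) rv)
    where
    isNbr? : ∀ u → Dec (T (adj H r u))
    isNbr? u = T? (adj H r u)
    neighbours : List (Fin m)
    neighbours = filter isNbr? (allFin m)

anotherVertex : ∀ {m} → 2 ≤ m → (r : Fin m) → ∃ λ u → u ≢ r
anotherVertex (s≤s (s≤s _)) zero    = suc zero , λ ()
anotherVertex (s≤s (s≤s _)) (suc _) = zero , λ ()

firstStep : ∀ {m} {H : Graph m} {P : Fin m → Set} {r u} → WalkIn H P r u → u ≢ r → ∃ (Adj H r)
firstStep (stay _)     r≢r = ⊥-elim (r≢r refl)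
firstStep (step _ e _) _   = _ , e

tree⇒separates : ∀ {m} {H : Graph m} {r : Fin m} → IsSimple H → Tree H →
  2 ≤ m → degree H r ≢ 1 → Separates H r
tree⇒separates {H = H} {r} simple ((_ , connected) , acyclic) m≥2 deg≢1
  with anotherVertex m≥2 r
... | u , u≢r with firstStep (connected r u) u≢r
... | _ , rv with twoNeighbours {H = H} rv deg≢1
... | a , b , ra , rb , a≢b = a , b , ra , rb , acyclic⇒separates simple acyclic ra rb a≢b

∣++∣ : ∀ {a b} (p : Subset a) (q : Subset b) → ∣ p ++ q ∣ ≡ ∣ p ∣ + ∣ q ∣
∣++∣ []          q = refl
∣++∣ (true ∷ p)  q = cong suc (∣++∣ p q)
∣++∣ (false ∷ p) q = ∣++∣ p q

∣concat∣≥ : ∀ {n m} k (ps : Vec (Subset m) n) →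
  (∀ i → k ≤ ∣ lookup ps i ∣) → n * k ≤ ∣ concat ps ∣
∣concat∣≥ k []       _   = z≤n
∣concat∣≥ k (p ∷ ps) big =
  subst (_ ≤_) (sym (∣++∣ p (concat ps)))
    (+-mono-≤ (big zero) (∣concat∣≥ k ps (big ∘ suc)))

∣concat-replicate∣ : ∀ n {m} (p : Subset m) → ∣ concat (replicate n p) ∣ ≡ n * ∣ p ∣
∣concat-replicate∣ zero    p = refl
∣concat-replicate∣ (suc n) p = trans (∣++∣ p _) (cong (∣ p ∣ +_) (∣concat-replicate∣ n p))

∈-concat⁺ : ∀ {n m} (ps : Vec (Subset m) n) i a → a ∈ lookup ps i → combine i a ∈ concat ps
∈-concat⁺ ps i a a∈ = lookup⇒[]= _ _ (trans (lookup-concat ps i a) ([]=⇒lookup a∈))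

∈-concat⁻ : ∀ {n m} (ps : Vec (Subset m) n) i a → combine i a ∈ concat ps → a ∈ lookup ps i
∈-concat⁻ ps i a a∈ = lookup⇒[]= _ _ (trans (sym (lookup-concat ps i a)) ([]=⇒lookup a∈))

module RootedProduct {n m} (G : Graph n) (H : Graph m) (r : Fin m) where

  P : Graph (n * m)
  P = rootedProduct G H r

  copy : Fin (n * m) → Fin n
  copy x = proj₁ (remQuot {n} m x)

  pos : Fin (n * m) → Fin m
  pos x = proj₂ (remQuot {n} m x)

  copy-combine : ∀ i a → copy (combine i a) ≡ i
  copy-combine i a = cong proj₁ (remQuot-combine {n} {m} i a)

  pos-combine : ∀ i a → pos (combine i a) ≡ a
  pos-combine i a = cong proj₂ (remQuot-combine {n} {m} i a)

  combine-copy-pos : ∀ x → combine (copy x) (pos x) ≡ x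
  combine-copy-pos = combine-remQuot {n} m

  byCoords : (Pr : Fin (n * m) → Set) → (∀ i a → Pr (combine i a)) → ∀ x → Pr x
  byCoords Pr h x = subst Pr (combine-copy-pos x) (h (copy x) (pos x))

  ProductAdj : Fin n → Fin m → Fin n → Fin m → Set
  ProductAdj i a j b = (i ≡ j × Adj H a b) ⊎ (a ≡ r × b ≡ r × Adj G i j)

  -- The Boolean adjacency of G ∘ H as a function of coordinates; by the
  -- definition of rootedProduct, Adj P x y unfolds to T (edge (remQuot x) (remQuot y)).
  edge : Fin n × Fin m → Fin n × Fin m → Bool
  edge (i , a) (j , b) = (does (i ≟ j) ∧ adj H a b) ∨ (does (a ≟ r) ∧ does (b ≟ r) ∧ adj G i j)

  edge-inv : ∀ i a j b → T (edge (i , a) (j , b)) → ProductAdj i a j b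
  edge-inv i a j b t with Equivalence.to (T-∨ {does (i ≟ j) ∧ adj H a b}) t
  ... | inj₁ inCopy with Equivalence.to (T-∧ {does (i ≟ j)}) inCopy
  ...   | same , h = inj₁ (T-does⁻ (i ≟ j) same , h)
  edge-inv i a j b t | inj₂ roots with Equivalence.to (T-∧ {does (a ≟ r)}) roots
  ...   | a-root , rest with Equivalence.to (T-∧ {does (b ≟ r)}) rest
  ...     | b-root , g = inj₂ (T-does⁻ (a ≟ r) a-root , T-does⁻ (b ≟ r) b-root , g)

  adj-inv : ∀ {x y} → Adj P x y → ProductAdj (copy x) (pos x) (copy y) (pos y)
  adj-inv {x} {y} = edge-inv (copy x) (pos x) (copy y) (pos y)

  adj-intro : ∀ {i a j b} → ProductAdj i a j b → Adj P (combine i a) (combine j b)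
  adj-intro {i} {a} {j} {b} pa =
    subst₂ (λ p q → T (edge p q)) (sym (remQuot-combine {n} {m} i a)) (sym (remQuot-combine {n} {m} j b))
      (encode pa)
    where
    encode : ProductAdj i a j b → T (edge (i , a) (j , b))
    encode (inj₁ (i≡j , h)) =
      Equivalence.from (T-∨ {does (i ≟ j) ∧ adj H a b})
        (inj₁ (Equivalence.from T-∧ (T-does⁺ (i ≟ j) i≡j , h)))
    encode (inj₂ (refl , refl , g)) =
      Equivalence.from (T-∨ {does (i ≟ j) ∧ adj H r r})
        (inj₂ (Equivalence.from T-∧ (T-does⁺ (r ≟ r) refl , Equivalence.from T-∧ (T-does⁺ (r ≟ r) refl , g))))

  adj-inCopy : ∀ i {a b} → Adj H a b → Adj P (combine i a) (combine i b)
  adj-inCopy i {a} {b} h = adj-intro {i} {a} {i} {b} (inj₁ (refl , h))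

  adj-roots : ∀ {i j} → Adj G i j → Adj P (combine i r) (combine j r)
  adj-roots {i} {j} g = adj-intro {i} {r} {j} {r} (inj₂ (refl , refl , g))

  slices : Subset (n * m) → Vec (Subset m) n
  slices D = proj₁ (group n m D)

  slice : Subset (n * m) → Fin n → Subset m
  slice D i = lookup (slices D) i

  concat-slices : ∀ D → D ≡ concat (slices D)
  concat-slices D = proj₂ (group n m D)

  ∈-slice⁺ : ∀ D {i a} → combine i a ∈ D → a ∈ slice D i
  ∈-slice⁺ D {i} {a} a∈ = ∈-concat⁻ (slices D) i a (subst (combine i a ∈_) (concat-slices D) a∈)

  ∈-slice⁻ : ∀ D {i a} → a ∈ slice D i → combine i a ∈ D
  ∈-slice⁻ D {i} {a} a∈ = subst (combine i a ∈_) (sym (concat-slices D)) (∈-concat⁺ (slices D) i a a∈)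

  ∈-ownSlice : ∀ D {x} → x ∈ D → pos x ∈ slice D (copy x)
  ∈-ownSlice D {x} x∈ = ∈-slice⁺ D (subst (_∈ D) (sym (combine-copy-pos x)) x∈)

  project : Fin n → Fin (n * m) → Fin m
  project i x with copy x ≟ i
  ... | yes _ = pos x
  ... | no _  = r

  project-on : ∀ i a → project i (combine i a) ≡ a
  project-on i a with copy (combine i a) ≟ i
  ... | yes _  = pos-combine i a
  ... | no ≢i = ⊥-elim (≢i (copy-combine i a))

  project-weakHom : ∀ i {x y} → Adj P x y →
    project i x ≡ project i y ⊎ Adj H (project i x) (project i y)
  project-weakHom i {x} {y} e with adj-inv e | copy x ≟ i | copy y ≟ i
  ... | inj₁ (_ , h)       | yes _  | yes _  = inj₂ h
  ... | inj₁ (same , _)    | yes cx | no ¬cy = ⊥-elim (¬cy (trans (sym same) cx))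
  ... | inj₁ (same , _)    | no ¬cx | yes cy = ⊥-elim (¬cx (trans same cy))
  ... | inj₁ _             | no _   | no _   = inj₁ refl
  ... | inj₂ (px , py , _) | yes _  | yes _  = inj₁ (trans px (sym py))
  ... | inj₂ (px , _ , _)  | yes _  | no _   = inj₁ px
  ... | inj₂ (_ , py , _)  | no _   | yes _  = inj₁ (sym py)
  ... | inj₂ _             | no _   | no _   = inj₁ refl

  project-∈ : ∀ D i {x} → x ∈ D → copy x ≡ i ⊎ combine i r ∈ D → project i x ∈ slice D i
  project-∈ D i {x} x∈ why with copy x ≟ i | why
  ... | yes refl | _            = ∈-ownSlice D x∈
  ... | no _     | inj₂ root∈  = ∈-slice⁺ D root∈
  ... | no ¬cx   | inj₁ cx     = ⊥-elim (¬cx cx)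

  -- If the root of H_i is not in D, a walk inside D starting in H_i never
  -- leaves H_i: every edge leaving H_i starts at its root.
  confined : ∀ {D i x y} → combine i r ∉ D → WalkIn P (_∈ D) x y → copy x ≡ i →
    WalkIn P (λ z → z ∈ D × copy z ≡ i) x y
  confined root∉ (stay x∈) cx = stay (x∈ , cx)
  confined {D} root∉ (step {u = x} x∈ e w) cx with adj-inv e
  ... | inj₁ (same , _) = step (x∈ , cx) e (confined root∉ w (trans (sym same) cx))
  ... | inj₂ (px , _ , _) =
    ⊥-elim (root∉ (subst (_∈ D) (trans (sym (combine-copy-pos x)) (cong₂ combine cx px)) x∈))

  -- Every slice of a linked set is linked: project a joining walk onto H_i,
  -- which is legitimate either because the root of H_i is in D, or because
  -- otherwise the walk is confined to H_i.
  slice-linked : ∀ D → Linked P D → ∀ i → Linked H (slice D i)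
  slice-linked D link i u v u∈ v∈ =
    subst₂ (WalkIn H (_∈ slice D i)) (project-on i u) (project-on i v)
      (mapWalk (project i) (project-weakHom i) (λ (z∈ , why) → project-∈ D i z∈ why) guarded)
    where
    joining : WalkIn P (_∈ D) (combine i u) (combine i v)
    joining = link _ _ (∈-slice⁻ D u∈) (∈-slice⁻ D v∈)
    guarded : WalkIn P (λ z → z ∈ D × (copy z ≡ i ⊎ combine i r ∈ D)) (combine i u) (combine i v)
    guarded with combine i r ∈? D
    ... | yes root∈ = restrict (λ z∈ → z∈ , inj₂ root∈) joining
    ... | no root∉  = restrict (λ (z∈ , cz) → z∈ , inj₁ cz) (confined root∉ joining (copy-combine i u))

  slice-dominates : ∀ D → (∀ x → Dominated P D x) → ∀ i a → a ≡ r ⊎ Dominated H (slice D i) a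
  slice-dominates D dom i a with dom (combine i a)
  ... | inj₁ a∈ = inj₂ (inj₁ (∈-slice⁺ D a∈))
  ... | inj₂ (y , y∈ , e) with adj-inv e
  ...   | inj₂ (a-root , _ , _) = inj₁ (trans (sym (pos-combine i a)) a-root)
  ...   | inj₁ (same , h) =
    inj₂ (inj₂ ( pos y
               , subst (λ j → pos y ∈ slice D j) (trans (sym same) (copy-combine i a)) (∈-ownSlice D y∈)
               , subst (λ c → Adj H c (pos y)) (pos-combine i a) h ))

  -- Copying a CDS of H that contains r into every copy gives a CDS of
  -- G ∘ H when G is connected: the copies are joined through their roots.
  copiesCDS : (∀ i j → WalkIn G (λ _ → ⊤) i j) → ∀ {S} → IsCDS H S → r ∈ S →
    IsCDS P (concat (replicate n S))
  copiesCDS connG {S} (dom , link) r∈S =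
    byCoords (Dominated P copies) dominated ,
    byCoords (λ x → ∀ y → x ∈ copies → y ∈ copies → WalkIn P (_∈ copies) x y) linked
    where
    copies : Subset (n * m)
    copies = concat (replicate n S)

    ∈-copies⁺ : ∀ i {a} → a ∈ S → combine i a ∈ copies
    ∈-copies⁺ i {a} a∈ =
      ∈-concat⁺ (replicate n S) i a (subst (a ∈_) (sym (lookup-replicate i S)) a∈)

    ∈-copies⁻ : ∀ i {a} → combine i a ∈ copies → a ∈ S
    ∈-copies⁻ i {a} a∈ = subst (a ∈_) (lookup-replicate i S) (∈-concat⁻ (replicate n S) i a a∈)

    dominated : ∀ i a → Dominated P copies (combine i a)
    dominated i a with dom a
    ... | inj₁ a∈             = inj₁ (∈-copies⁺ i a∈)
    ... | inj₂ (b , b∈ , ab) = inj₂ (combine i b , ∈-copies⁺ i b∈ , adj-inCopy i ab)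

    inCopy : ∀ i {a b} → WalkIn H (_∈ S) a b → WalkIn P (_∈ copies) (combine i a) (combine i b)
    inCopy i = mapWalk (combine i) (inj₂ ∘ adj-inCopy i) (∈-copies⁺ i)

    alongRoots : ∀ {i j} → WalkIn G (λ _ → ⊤) i j → WalkIn P (_∈ copies) (combine i r) (combine j r)
    alongRoots = mapWalk (λ i → combine i r) (inj₂ ∘ adj-roots) (λ {i} _ → ∈-copies⁺ i r∈S)

    linked : ∀ i a y → combine i a ∈ copies → y ∈ copies → WalkIn P (_∈ copies) (combine i a) y
    linked i a = byCoords _ λ j b a∈ b∈ →
      inCopy i (link a r (∈-copies⁻ i a∈) r∈S)
        ▸ alongRoots (connG i j)
        ▸ inCopy j (link r b r∈S (∈-copies⁻ j b∈))

  module _ (simpleH : IsSimple H) (cut : Separates H r) where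

    roots∈CDS : ∀ {D} → IsCDS P D → ∀ i → combine i r ∈ D
    roots∈CDS {D} (dom , link) i =
      ∈-slice⁻ D (cutVertex∈ simpleH cut (slice D i) nonRootDominated (slice-linked D link i))
      where
      nonRootDominated : ∀ a → a ≢ r → Dominated H (slice D i) a
      nonRootDominated a a≢r with slice-dominates D dom i a
      ... | inj₁ a≡r = ⊥-elim (a≢r a≡r)
      ... | inj₂ d   = d

    slice-CDS : ∀ {D} → IsCDS P D → ∀ i → IsCDS H (slice D i)
    slice-CDS {D} cds@(dom , link) i = dominated , slice-linked D link i
      where
      dominated : ∀ a → Dominated H (slice D i) a
      dominated a with slice-dominates D dom i a
      ... | inj₁ refl = inj₁ (∈-slice⁺ D (roots∈CDS cds i))
      ... | inj₂ d    = d

mainTheorem20 : ∀ {n m} (G : Graph n) (H : Graph m) (r : Fin m) →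
    IsSimple G → Connected G →
    IsSimple H → Tree H → m ≥ 3 → ¬ (degree H r ≡ 1) →
    ∀ k → IsConnDomNumber H k → IsConnDomNumber (rootedProduct G H r) (n * k)
mainTheorem20 {n} G H r _ (_ , connG) simpleH treeH m≥3 deg≢1 k ((S , cdsS , ∣S∣≡k) , minimal) =
  (concat (replicate n S) , copiesCDS connG cdsS r∈S , copiesSize) , lowerBound
  where
  open RootedProduct G H r

  cut : Separates H r
  cut = tree⇒separates simpleH treeH (≤-trans (n≤1+n 2) m≥3) deg≢1

  r∈S : r ∈ S
  r∈S = cutVertex∈ simpleH cut S (λ v _ → proj₁ cdsS v) (proj₂ cdsS)

  copiesSize : ∣ concat (replicate n S) ∣ ≡ n * k
  copiesSize = trans (∣concat-replicate∣ n S) (cong (n *_) ∣S∣≡k)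

  lowerBound : ∀ D → IsCDS P D → n * k ≤ ∣ D ∣
  lowerBound D cds =
    subst (λ E → n * k ≤ ∣ E ∣) (sym (concat-slices D))
      (∣concat∣≥ k (slices D) (λ i → minimal (slice D i) (slice-CDS simpleH cut cds i)))
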